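{- Let $\mathbb P$ be an atomless ccc countably-1-generated separative Souslin forcing notion and $\pi$ a basis for $\mathbb P$. If $\pi$ is index invariant then the ideal $\mathcal I_{\mathbb P}$ is weakly index invariant. If $\pi$ is permutation invariant then $\mathcal I_{\mathbb P}$ is permutation invariant.
   Context: Convention: stronger condition is greater; $\perp$ is incompatibility; $\mathbb P$ has a weakest element $\emptyset_{\mathbb P}$. Souslin: $\mathbb P$ is a $\Sigma^1_1$ set of reals with $\le_{\mathbb P},\perp_{\mathbb P}$ $\Sigma^1_1$. Separative: if $p\not\le q$ there is $q_0\ge q$ with $q_0\perp p$. Countably-1-generated: there are $p_n$ ($\sigma$-1-generators) such that for all $p$ and all $q\perp p$ some $p_n\perp p$ is compatible with $q$. A basis is $\pi:\omega^{<\omega}\to\mathbb P$ such that each $\{\pi(s^\frown n):n\in\omega\}$ is a maximal antichain above $\pi(s)$, $\pi(\langle\rangle)=\emptyset_{\mathbb P}$, and $\mathrm{rng}(\pi)$ is a set of $\sigma$-1-generators. $\phi(p)=\{x\in\omega^\omega:\forall n\ (\pi(x\restriction n)\text{ compatible with }p)\}$. $A\subseteq\omega^\omega$ is $\mathbb P$-small if some maximal antichain $\mathcal A\subseteq\mathbb P$ has $A\cap\bigcup_{p\in\mathcal A}\phi(p)=\emptyset$; $\mathcal I_{\mathbb P}$ is the family of sets covered by countably many $\mathbb P$-small sets. The basis $\pi$ is index invariant if for every permutation $P$ of $\omega$ there is an automorphism $a_P$ of $\mathbb P$ with $\phi(a_P(p))=\{x\circ P:x\in\phi(p)\}$ for all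 $p$. It is permutation invariant if for every sequence $\bar P=\langle P_n:n\in\omega\rangle$ of permutations of $\omega$ there is an automorphism $a^{\bar P}$ of $\mathbb P$ with $\phi(a^{\bar P}(p))=\{\bar P(x):x\in\phi(p)\}$ for all $p$, where $\bar P(x)(n)=P_n(x(n))$. An ideal $\mathcal I$ on $\omega^\omega$ is weakly index invariant if for every permutation $P$ of $\omega$ and $A\subseteq\omega^\omega$: $A\in\mathcal I$ iff $\{x\circ P:x\in A\}\in\mathcal I$. It is permutation invariant if for every sequence $\bar P$ of permutations of $\omega$ and $A\subseteq\omega^\omega$: $A\in\mathcal I$ iff $\{\bar P(x):x\in A\}\in\mathcal I$. -}

module Defs where

open import Level using (Level; 0ℓ) renaming (suc to lsuc)
open import Data.Nat using (ℕ; zero; suc)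
open import Data.List using (List; []; _∷_; _∷ʳ_)
open import Data.Product using (Σ; ∃; ∃-syntax; _×_; _,_)
open import Relation.Nullary using (¬_)
open import Relation.Binary.PropositionalEquality using (_≡_; _≢_)
open import Function.Bundles using (_↔_; Inverse)

Baire : Set
Baire = ℕ → ℕ

_≈ᴮ_ : Baire → Baire → Set
x ≈ᴮ y = ∀ n → x n ≡ y n

_↾_ : Baire → ℕ → List ℕ
x ↾ zero    = []
x ↾ (suc n) = (x ↾ n) ∷ʳ x n

SetB : Set₁
SetB = Baire → Set

-- boldface Σ^1_1 subsets of ω^ω: projections of closed subsets of ω^ω × ω^ω
Σ¹₁ : SetB → Set₁
Σ¹₁ A = Σ (List ℕ → List ℕ → Set) λ T →
          ∀ x → (A x → ∃[ y ] (∀ n → T (x ↾ n) (y ↾ n)))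
              × (∃[ y ] (∀ n → T (x ↾ n) (y ↾ n)) → A x)

Σ¹₁² : (Baire → Baire → Set) → Set₁
Σ¹₁² R = Σ (List ℕ → List ℕ → List ℕ → Set) λ T →
          ∀ x y → (R x y → ∃[ z ] (∀ n → T (x ↾ n) (y ↾ n) (z ↾ n)))
                × (∃[ z ] (∀ n → T (x ↾ n) (y ↾ n) (z ↾ n)) → R x y)

-- Forcing notions (stronger condition is greater), with weakest element

record Forcing : Set₁ where
  field
    Carrier : Set
    _≤_     : Carrier → Carrier → Set
    ≤-refl  : ∀ p → p ≤ p
    ≤-trans : ∀ {p q r} → p ≤ q → q ≤ r → p ≤ r
    ∅       : Carrier
    ∅-least : ∀ p → ∅ ≤ p

module _ (ℙ : Forcing) where
  open Forcing ℙ

  Compatible : Carrier → Carrier → Set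
  Compatible p q = ∃[ r ] (p ≤ r × q ≤ r)

  _⊥_ : Carrier → Carrier → Set
  p ⊥ q = ¬ Compatible p q

  Atomless : Set
  Atomless = ∀ p → ∃[ q ] ∃[ r ] (p ≤ q × p ≤ r × q ⊥ r)

  Separative : Set
  Separative = ∀ p q → ¬ (p ≤ q) → ∃[ q₀ ] (q ≤ q₀ × q₀ ⊥ p)

  IsAntichain : (Carrier → Set) → Set
  IsAntichain A = ∀ p q → A p → A q → p ≢ q → p ⊥ q

  IsMaximalAntichain : (Carrier → Set) → Set
  IsMaximalAntichain A = IsAntichain A × (∀ q → ∃[ p ] (A p × Compatible p q))

  IsCountable : (Carrier → Set) → Set
  IsCountable A = Σ (ℕ → Carrier) λ f → (∀ p → A p → ∃[ n ] (f n ≡ p))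

  CCC : Set₁
  CCC = ∀ (A : Carrier → Set) → IsAntichain A → IsCountable A

  AreGenerators : ∀ {I : Set} → (I → Carrier) → Set
  AreGenerators {I} g = ∀ p q → q ⊥ p → ∃[ i ] ((g i ⊥ p) × Compatible (g i) q)

  Countably1Generated : Set
  Countably1Generated = Σ (ℕ → Carrier) λ g → AreGenerators {ℕ} g

  record Souslin : Set₁ where
    field
      code      : Carrier → Baire
      code-inj  : ∀ p q → code p ≈ᴮ code q → p ≡ q
      carrier-Σ : Σ¹₁ (λ x → ∃[ p ] (code p ≈ᴮ x))
      ≤-Σ       : Σ¹₁² (λ x y → ∃[ p ] ∃[ q ] (code p ≈ᴮ x × code q ≈ᴮ y × p ≤ q))
      ⊥-Σ       : Σ¹₁² (λ x y → ∃[ p ] ∃[ q ] (code p ≈ᴮ x × code q ≈ᴮ y × p ⊥ q))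

  record Basis : Set where
    field
      π          : List ℕ → Carrier
      π-root     : π [] ≡ ∅
      π-above    : ∀ s n → π s ≤ π (s ∷ʳ n)
      π-antichain : ∀ s n m → n ≢ m → π (s ∷ʳ n) ⊥ π (s ∷ʳ m)
      π-maximal  : ∀ s q → π s ≤ q → ∃[ n ] Compatible (π (s ∷ʳ n)) q
      π-generators : AreGenerators π

  module _ (B : Basis) where
    open Basis B

    φ : Carrier → SetB
    φ p x = ∀ n → Compatible (π (x ↾ n)) p

    Small : SetB → Set₁
    Small A = Σ (Carrier → Set) λ 𝒜 → (IsMaximalAntichain 𝒜 × (∀ x → A x → ∀ p → 𝒜 p → ¬ φ p x))

    Iℙ : SetB → Set₁
    Iℙ A = Σ (ℕ → SetB) λ C → ((∀ (n : ℕ) → Small (C n)) × (∀ x → A x → ∃[ n ] C n x))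

  record Automorphism : Set where
    field
      fun     : Carrier → Carrier
      inv     : Carrier → Carrier
      inv-fun : ∀ p → inv (fun p) ≡ p
      fun-inv : ∀ p → fun (inv p) ≡ p
      mono    : ∀ p q → p ≤ q → fun p ≤ fun q
      refl'   : ∀ p q → fun p ≤ fun q → p ≤ q

Perm : Set
Perm = ℕ ↔ ℕ

_∘ᴾ_ : SetB → Perm → SetB
(A ∘ᴾ P) y = ∃[ x ] (A x × (∀ n → y n ≡ x (Inverse.to P n)))

_·ᴾ_ : (ℕ → Perm) → SetB → SetB
(P̄ ·ᴾ A) y = ∃[ x ] (A x × (∀ n → y n ≡ Inverse.to (P̄ n) (x n)))

SameSet : SetB → SetB → Set
SameSet A B = ∀ x → (A x → B x) × (B x → A x)

module _ (ℙ : Forcing) (B : Basis ℙ) where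
  open Basis B

  IndexInvariantBasis : Set
  IndexInvariantBasis = ∀ (P : Perm) → ∃[ a ]
    (∀ p → SameSet (φ ℙ B (Automorphism.fun {ℙ} a p)) (φ ℙ B p ∘ᴾ P))

  PermInvariantBasis : Set
  PermInvariantBasis = ∀ (P̄ : ℕ → Perm) → ∃[ a ]
    (∀ p → SameSet (φ ℙ B (Automorphism.fun {ℙ} a p)) (P̄ ·ᴾ φ ℙ B p))

WeaklyIndexInvariant : (SetB → Set₁) → Set₁
WeaklyIndexInvariant I = ∀ (P : Perm) (A : SetB) → (I A → I (A ∘ᴾ P)) × (I (A ∘ᴾ P) → I A)

PermInvariantIdeal : (SetB → Set₁) → Set₁
PermInvariantIdeal I = ∀ (P̄ : ℕ → Perm) (A : SetB) → (I A → I (P̄ ·ᴾ A)) × (I (P̄ ·ᴾ A) → I A)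

{-# OPTIONS --safe #-}
-- If an automorphism a of ℙ satisfies φ(a p) = h[φ p] for a bijection h of
-- ω^ω, then a carries a maximal antichain witnessing that C is small to one
-- witnessing that h[C] is small, and countable covers are carried along by
-- taking images.  Both x ↦ x ∘ P and x ↦ P̄(x) are such bijections, with
-- inverses of the same kind, which gives both inclusions.
module Submission where

open import Defs
open import Data.Nat using (ℕ; zero; suc)
open import Data.List using (_∷ʳ_)
open import Data.Product using (_×_; _,_; ∃-syntax; proj₁)
open import Function using (_∘_)
open import Function.Bundles using (Inverse)
open import Function.Properties.Inverse using (↔-sym)
open import Relation.Binary.PropositionalEquality
  using (_≡_; refl; sym; trans; cong; cong₂; subst; subst₂)
open import Relation.Nullary using (¬_)
open import Relation.Unary using (_⊆_)

Image : (Baire → Baire) → SetB → SetB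
Image h A y = ∃[ x ] (A x × y ≈ᴮ h x)

Congruent : (Baire → Baire) → Set
Congruent h = ∀ {x y} → x ≈ᴮ y → h x ≈ᴮ h y

LeftInverse : (Baire → Baire) → (Baire → Baire) → Set
LeftInverse g h = ∀ x → g (h x) ≈ᴮ x

≈ᴮ-sym : ∀ {x y} → x ≈ᴮ y → y ≈ᴮ x
≈ᴮ-sym e n = sym (e n)

≈ᴮ-trans : ∀ {x y z} → x ≈ᴮ y → y ≈ᴮ z → x ≈ᴮ z
≈ᴮ-trans e e′ n = trans (e n) (e′ n)

↾-cong : ∀ {x y} → x ≈ᴮ y → ∀ n → x ↾ n ≡ y ↾ n
↾-cong e zero    = refl
↾-cong e (suc n) = cong₂ _∷ʳ_ (↾-cong e n) (e n)

injective-if-leftInverse : ∀ {g h} → Congruent g → LeftInverse g h →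
                           ∀ {x y} → h x ≈ᴮ h y → x ≈ᴮ y
injective-if-leftInverse {g} {h} g-cong g∘h≈id {x} {y} e =
  ≈ᴮ-trans (≈ᴮ-sym (g∘h≈id x)) (≈ᴮ-trans (g-cong e) (g∘h≈id y))

⊆-Image-Image : ∀ {g h} → LeftInverse g h → ∀ A → A ⊆ Image g (Image h A)
⊆-Image-Image {h = h} g∘h≈id A {x} ax = h x , (x , ax , λ _ → refl) , ≈ᴮ-sym (g∘h≈id x)

module AutomorphismProperties {ℙ : Forcing} (a : Automorphism ℙ) where
  open Forcing ℙ
  open Automorphism a

  inv-mono : ∀ {q r} → q ≤ r → inv q ≤ inv r
  inv-mono {q} {r} q≤r = refl' (inv q) (inv r) (subst₂ _≤_ (sym (fun-inv q)) (sym (fun-inv r)) q≤r)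

  inv-reflects-⊥ : ∀ {q r} → _⊥_ ℙ (inv q) (inv r) → _⊥_ ℙ q r
  inv-reflects-⊥ inv-q⊥inv-r (s , q≤s , r≤s) = inv-q⊥inv-r (inv s , inv-mono q≤s , inv-mono r≤s)

  preimage-maximalAntichain : ∀ {𝒜} → IsMaximalAntichain ℙ 𝒜 → IsMaximalAntichain ℙ (𝒜 ∘ inv)
  preimage-maximalAntichain {𝒜} (antichain , maximal) = antichain′ , maximal′
    where
    antichain′ : IsAntichain ℙ (𝒜 ∘ inv)
    antichain′ q r 𝒜q 𝒜r q≢r = inv-reflects-⊥ (antichain (inv q) (inv r) 𝒜q 𝒜r
      (λ e → q≢r (trans (sym (fun-inv q)) (trans (cong fun e) (fun-inv r)))))

    maximal′ : ∀ q → ∃[ p ] ((𝒜 ∘ inv) p × Compatible ℙ p q)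
    maximal′ q with maximal (inv q)
    ... | p , 𝒜p , r , p≤r , inv-q≤r =
      fun p , subst 𝒜 (sym (inv-fun p)) 𝒜p ,
      fun r , mono p r p≤r , subst (_≤ fun r) (fun-inv q) (mono (inv q) r inv-q≤r)

module _ (ℙ : Forcing) (B : Basis ℙ) where
  open Automorphism

  φ-resp-≈ᴮ : ∀ p {x y} → x ≈ᴮ y → φ ℙ B p x → φ ℙ B p y
  φ-resp-≈ᴮ p e φpx n = subst (λ s → Compatible ℙ (Basis.π B s) p) (↾-cong e n) (φpx n)

  Iℙ-downwardsClosed : ∀ {A A′} → A ⊆ A′ → Iℙ ℙ B A′ → Iℙ ℙ B A
  Iℙ-downwardsClosed A⊆A′ (C , small , cover) = C , small , λ x ax → cover x (A⊆A′ ax)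

  Implements : Automorphism ℙ → (Baire → Baire) → Set
  Implements a h = ∀ p → SameSet (φ ℙ B (fun a p)) (Image h (φ ℙ B p))

  Implemented : (Baire → Baire) → Set
  Implemented h = ∃[ a ] Implements a h

  module _ {a h} (a-implements-h : Implements a h)
           (h-injective : ∀ {x y} → h x ≈ᴮ h y → x ≈ᴮ y) where
    open AutomorphismProperties a

    Small-Image : ∀ {C} → Small ℙ B C → Small ℙ B (Image h C)
    Small-Image {C} (𝒜 , 𝒜-maximal , C-avoids-𝒜) =
      𝒜 ∘ inv a , preimage-maximalAntichain 𝒜-maximal , avoids
      where
      avoids : ∀ y → Image h C y → ∀ q → 𝒜 (inv a q) → ¬ φ ℙ B q y
      avoids y (x , cx , y≈hx) q 𝒜q φqy
        with proj₁ (a-implements-h (inv a q) y)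
                   (subst (λ r → φ ℙ B r y) (sym (fun-inv a q)) φqy)
      ... | x′ , φx′ , y≈hx′ =
        C-avoids-𝒜 x cx (inv a q) 𝒜q
          (φ-resp-≈ᴮ (inv a q) (h-injective (≈ᴮ-trans (≈ᴮ-sym y≈hx′) y≈hx)) φx′)

    Iℙ-Image : ∀ {A} → Iℙ ℙ B A → Iℙ ℙ B (Image h A)
    Iℙ-Image (C , small , cover) =
      Image h ∘ C , Small-Image ∘ small ,
      λ { y (x , ax , y≈hx) → let n , cₙx = cover x ax in n , x , cₙx , y≈hx }

  Iℙ-Image-invariant : ∀ {h g} → Congruent h → Congruent g →
                       LeftInverse g h → LeftInverse h g →
                       Implemented h → Implemented g →
                       ∀ A → (Iℙ ℙ B A → Iℙ ℙ B (Image h A)) × (Iℙ ℙ B (Image h A) → Iℙ ℙ B A)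
  Iℙ-Image-invariant {h} {g} h-cong g-cong g∘h≈id h∘g≈id (a , a-implements-h) (b , b-implements-g) A =
    Iℙ-Image {a} {h} a-implements-h (injective-if-leftInverse g-cong g∘h≈id) ,
    Iℙ-downwardsClosed (⊆-Image-Image g∘h≈id A)
      ∘ Iℙ-Image {b} {g} b-implements-g (injective-if-leftInverse h-cong h∘g≈id)

-- A ∘ᴾ P and P̄ ·ᴾ A are definitionally Image (reindex P) A and Image (act P̄) A.
reindex : Perm → Baire → Baire
reindex P x = x ∘ Inverse.to P

act : (ℕ → Perm) → Baire → Baire
act P̄ x n = Inverse.to (P̄ n) (x n)

reindex-cong : ∀ P → Congruent (reindex P)
reindex-cong P e = e ∘ Inverse.to P

reindex-leftInverse : ∀ P → LeftInverse (reindex (↔-sym P)) (reindex P)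
reindex-leftInverse P x = cong x ∘ Inverse.strictlyInverseˡ P

act-cong : ∀ P̄ → Congruent (act P̄)
act-cong P̄ e n = cong (Inverse.to (P̄ n)) (e n)

act-leftInverse : ∀ P̄ → LeftInverse (act (↔-sym ∘ P̄)) (act P̄)
act-leftInverse P̄ x n = Inverse.strictlyInverseʳ (P̄ n) (x n)

proposition3p3 : (ℙ : Forcing) → Atomless ℙ → CCC ℙ → Countably1Generated ℙ → Separative ℙ → Souslin ℙ
    → (B : Basis ℙ)
    → (IndexInvariantBasis ℙ B → WeaklyIndexInvariant (Iℙ ℙ B))
    × (PermInvariantBasis ℙ B → PermInvariantIdeal (Iℙ ℙ B))
proposition3p3 ℙ _ _ _ _ _ B = index-invariant , permutation-invariant
  where
  index-invariant : IndexInvariantBasis ℙ B → WeaklyIndexInvariant (Iℙ ℙ B)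
  index-invariant implemented P =
    Iℙ-Image-invariant ℙ B (reindex-cong P) (reindex-cong (↔-sym P))
      (reindex-leftInverse P) (reindex-leftInverse (↔-sym P))
      (implemented P) (implemented (↔-sym P))

  permutation-invariant : PermInvariantBasis ℙ B → PermInvariantIdeal (Iℙ ℙ B)
  permutation-invariant implemented P̄ =
    Iℙ-Image-invariant ℙ B (act-cong P̄) (act-cong (↔-sym ∘ P̄))
      (act-leftInverse P̄) (act-leftInverse (↔-sym ∘ P̄))
      (implemented P̄) (implemented (↔-sym ∘ P̄))
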